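{- Suppose that $p_i = 3$ for some $i \in S_n$ and that there exists $j \in S_n \setminus \{i\}$ such that $\{j\} \in \mathcal D^{\mathrm{op}}$. Then exactly one of the following holds: (1) $\varepsilon_{ -j} = -1$ and $\alpha_j$ is even; (2) $\varepsilon_{ -j} = -1$, $\alpha_j$ is odd and $p_j \equiv 1 \pmod 6$; (3) $\varepsilon_{ -j} = 1$, $\alpha_j$ is odd and $p_j \equiv 2 \pmod 3$.
   Context: Standing setting: $n \ge 3$ is an integer, $S_n = \{1,\ldots,n\}$; for a set $X$, $\mathcal P_\star(X)$ is the family of finite nonempty proper subsets of $X$ and $\mathcal P_k(X)$ the family of $k$-element subsets. Let $p_1 < p_2 < \cdots < p_n$ be primes, $\mathfrak P = \{p_1,\ldots,p_n\}$, $v_1,\ldots,v_n$ positive integers, $\mathcal D$ a nonempty subfamily of $\mathcal P_\star(S_n)$, and $\varepsilon:\mathcal P_\star(S_n)\to\{\pm1\}$ a map, with $\varepsilon_I := \varepsilon(I)$. Standing hypothesis: every prime $q$ dividing $\prod_{i\in I} p_i^{v_i} - \varepsilon_I$ for some $I \in \mathcal D$ belongs to $\mathfrak P$. Notation: $\mathcal D^{\mathrm{op}} := \{S_n\setminus I : I \in \mathcal D\}$; for $I \in \mathcal P_\star(S_n)$, $P_I := \prod_{i\in I} p_i^{v_i}$, $P_{ -I} := P_{S_n\setminus I}$, $\varepsilon_{ -I} := \varepsilon_{S_n\setminus I}$; for $i\in S_n$, $P_i := P_{\{i\}}$, $P_{ -i} := P_{ -\{i\}}$, $\varepsilon_i :=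 \varepsilon_{\{i\}}$, $\varepsilon_{ -i} := \varepsilon_{ -\{i\}}$. For $I \in \mathcal D^{\mathrm{op}}$ and $i\in I$, $\alpha_{i,I}$ denotes the exponent of $p_i$ in the positive integer $P_{ -I} - \varepsilon_{ -I}$; under the standing hypothesis one has $P_{ -I} = \varepsilon_{ -I} + \prod_{i\in I} p_i^{\alpha_{i,I}}$. For $\{i\}\in\mathcal D^{\mathrm{op}}$, $\alpha_i := \alpha_{i,\{i\}}$, so $P_{ -i} = p_i^{\alpha_i} + \varepsilon_{ -i}$. -}

module Defs where

open import Data.Nat using (ℕ; _≤_; _^_; _%_; _+_; suc)
open import Data.Nat.Divisibility using () renaming (_∣_ to _∣ℕ_)
open import Data.Nat.ListAction using (product)
open import Data.Nat.Primality using (Prime)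
open import Data.Integer as ℤ using (ℤ; +_)
open import Data.Integer.Divisibility as ℤD using ()
open import Data.Fin using (Fin; _<_)
open import Data.Fin.Subset using (Subset; _∈_; _∉_; Nonempty; ∁; ⁅_⁆)
open import Data.Fin.Subset.Properties using (_∈?_)
open import Data.Sign using (Sign)
open import Data.List using (map; allFin)
open import Data.Product using (Σ; ∃; _×_)
open import Data.Sum using (_⊎_)
open import Relation.Nullary using (¬_; does)
open import Relation.Binary.PropositionalEquality using (_≡_)
open import Data.Bool using (if_then_else_)

sgn : Sign → ℤ
sgn Sign.+ = + 1
sgn Sign.- = ℤ.- (+ 1)

P : ∀ {n} → (Fin n → ℕ) → (Fin n → ℕ) → Subset n → ℕ
P {n} p v I = product (map (λ i → if does (i ∈? I) then p i ^ v i else 1) (allFin n))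

Proper⋆ : ∀ {n} → Subset n → Set
Proper⋆ I = Nonempty I × Nonempty (∁ I)

-- The standing setting of the paper.  S_n is modelled by Fin n.
record Setting (n : ℕ) : Set₁ where
  field
    n≥3     : 3 ≤ n
    p       : Fin n → ℕ
    p-prime : ∀ i → Prime (p i)
    p-mono  : ∀ i j → i < j → Data.Nat._<_ (p i) (p j)
    v       : Fin n → ℕ
    v-pos   : ∀ i → 1 ≤ v i
    D       : Subset n → Set
    D⊆P⋆    : ∀ I → D I → Proper⋆ I
    D-ne    : ∃ λ I → D I
    ε       : Subset n → Sign
    standing : ∀ I → D I → ∀ q → Prime q →
               (+ q) ℤD.∣ ((+ P p v I) ℤ.- sgn (ε I)) → ∃ λ i → q ≡ p i

  P₋ : Fin n → ℕ
  P₋ j = P p v (∁ ⁅ j ⁆)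

  ε₋ : Fin n → Sign
  ε₋ j = ε (∁ ⁅ j ⁆)

  -- {j} ∈ D^op  iff  S_n \ {j} ∈ D
  InDop₁ : Fin n → Set
  InDop₁ j = D (∁ ⁅ j ⁆)

  -- the positive integer P_{-j} - ε_{-j}, as a natural number
  N₋ : Fin n → ℕ
  N₋ j = ℤ.∣ (+ P₋ j) ℤ.- sgn (ε₋ j) ∣

  IsAlpha : Fin n → ℕ → Set
  IsAlpha j a = (p j ^ a) ∣ℕ N₋ j × ¬ ((p j ^ suc a) ∣ℕ N₋ j)

ExactlyOne3 : Set → Set → Set → Set
ExactlyOne3 A B C = (A ⊎ B ⊎ C) × ¬ (A × B) × ¬ (A × C) × ¬ (B × C)

module Submission where

-- Put N = P_{-j} - ε_{-j} (a positive integer).  Every p_k with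
-- k ≠ j divides P_{-j}, hence is coprime to N; by the standing hypothesis
-- p_j is therefore the only prime dividing N, and the exactness of α forces
-- N = p_j^α.  As i ≠ j, 3 = p_i divides P_{-j}, so p_j^α ≡ -ε_{-j} (mod 3),
-- i.e. p_j^α ≡ 1 (mod 3) when ε_{-j} = -1 and p_j^α ≡ 2 (mod 3) when
-- ε_{-j} = 1.  Running through the residues of p_j modulo 3 and the parity of
-- α yields one of the three cases (a prime ≡ 1 mod 3 is odd, hence ≡ 1 mod 6);
-- the cases are mutually exclusive by sign and parity alone.

open import Defs
open import Data.Nat using (ℕ; _%_)
open import Data.Fin using (Fin)
open import Data.Sign using (Sign)
open import Data.Product using (_×_)
open import Relation.Nullary using (¬_)
open import Relation.Binary.PropositionalEquality using (_≡_)

open import Data.Nat using (zero; suc; _+_; _*_; _^_; _∸_; _≤_; z≤n; s≤s; NonZero)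
open import Data.Nat.Properties
  using (+-comm; +-identityʳ; *-comm; *-assoc; ^-zeroˡ; m^n≢0)
open import Data.Nat.DivMod
  using (m%n<n; m%n%n≡m%n; [m+n]%n≡m%n; [m+kn]%n≡m%n; %-distribˡ-*;
         %-remove-+ˡ; %-pred-≡0; m∣n⇒o%n%m≡o%m)
open import Data.Nat.Divisibility
  using (_∣_; divides; ∣-trans; m∣m*n; _∣0; ∣1⇒≡1; ∣m+n∣m⇒∣n; *-monoˡ-∣;
         m%n≡0⇒n∣m; n∣m⇒m%n≡0)
open import Data.Nat.Primality using (Prime; prime⇒irreducible; prime⇒nonZero; ¬prime[1])
open import Data.Nat.Primality.Factorisation using (factorise)
open import Data.Nat.ListAction.Properties using (∈⇒∣product; product≢0)
import Data.Integer as ℤ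
open import Data.Fin using (_≟_)
open import Data.Fin.Subset using (∁; ⁅_⁆)
open import Data.Fin.Subset.Properties using (_∈?_; x∉p⇒x∈∁p; x≢y⇒x∉⁅y⁆)
open import Data.List using ([]; _∷_; allFin)
open import Data.List.Relation.Unary.All using (_∷_; tabulate)
open import Data.List.Relation.Unary.All.Properties using (map⁺)
open import Data.List.Membership.Propositional.Properties using (∈-allFin; ∈-map⁺)
open import Data.List.Relation.Unary.Any using (here)
open import Data.Product using (∃; _,_)
open import Data.Sum using (_⊎_; inj₁; inj₂; map₂)
open import Data.Bool using (if_then_else_)
open import Relation.Nullary using (yes; no; does; contradiction)
open import Relation.Binary.PropositionalEquality
  using (refl; sym; trans; cong; subst; _≢_; module ≡-Reasoning)

parity : ∀ a → a % 2 ≡ 0 ⊎ a % 2 ≡ 1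
parity a with a % 2 | m%n<n a 2
... | 0 | _ = inj₁ refl
... | 1 | _ = inj₂ refl
... | suc (suc _) | s≤s (s≤s ())

residue-mod-3 : ∀ q → q % 3 ≡ 0 ⊎ q % 3 ≡ 1 ⊎ q % 3 ≡ 2
residue-mod-3 q with q % 3 | m%n<n q 3
... | 0 | _ = inj₁ refl
... | 1 | _ = inj₂ (inj₁ refl)
... | 2 | _ = inj₂ (inj₂ refl)
... | suc (suc (suc _)) | s≤s (s≤s (s≤s ()))

parity-step : ∀ a → suc (suc a) % 2 ≡ a % 2
parity-step a = trans (cong (_% 2) (+-comm 2 a)) ([m+n]%n≡m%n a 2)

^-%-base : ∀ m n d .{{_ : NonZero d}} → m ^ n % d ≡ (m % d) ^ n % d
^-%-base m zero d = refl
^-%-base m (suc n) d = begin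
  m * m ^ n % d                      ≡⟨ %-distribˡ-* m (m ^ n) d ⟩
  m % d * (m ^ n % d) % d            ≡⟨ cong (λ x → m % d * x % d) (^-%-base m n d) ⟩
  m % d * ((m % d) ^ n % d) % d      ≡⟨ cong (λ x → x * ((m % d) ^ n % d) % d) (sym (m%n%n≡m%n m d)) ⟩
  m % d % d * ((m % d) ^ n % d) % d  ≡⟨ sym (%-distribˡ-* (m % d) ((m % d) ^ n) d) ⟩
  (m % d) * (m % d) ^ n % d          ∎
  where open ≡-Reasoning

-- 4 ≡ 1 (mod 3), so multiplying by 2 twice does not change a residue mod 3.
times-4-mod-3 : ∀ x → 2 * (2 * x) % 3 ≡ x % 3
times-4-mod-3 x = trans (cong (_% 3) 2*2*x≡x+x*3) ([m+kn]%n≡m%n x x 3)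
  where
  2*2*x≡x+x*3 : 2 * (2 * x) ≡ x + x * 3
  2*2*x≡x+x*3 = trans (sym (*-assoc 2 2 x)) (cong (x +_) (*-comm 3 x))

powers-of-2-mod-3 : ∀ a → (a % 2 ≡ 0 × 2 ^ a % 3 ≡ 1) ⊎ (a % 2 ≡ 1 × 2 ^ a % 3 ≡ 2)
powers-of-2-mod-3 zero = inj₁ (refl , refl)
powers-of-2-mod-3 (suc zero) = inj₂ (refl , refl)
powers-of-2-mod-3 (suc (suc a)) with powers-of-2-mod-3 a
... | inj₁ (even , r) = inj₁ (trans (parity-step a) even , trans (times-4-mod-3 (2 ^ a)) r)
... | inj₂ (odd , r)  = inj₂ (trans (parity-step a) odd , trans (times-4-mod-3 (2 ^ a)) r)

-- A prime ≡ 1 (mod 3) is not 2, hence odd, hence ≡ 1 (mod 6).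
prime≡1mod3⇒≡1mod6 : ∀ q → Prime q → q % 3 ≡ 1 → q % 6 ≡ 1
prime≡1mod3⇒≡1mod6 q q-prime q≡1 with q % 6 | m%n<n q 6
                                     | m∣n⇒o%n%m≡o%m 3 6 q (divides 2 refl)
                                     | m∣n⇒o%n%m≡o%m 2 6 q (divides 3 refl)
... | 0 | _ | mod3 | _ = contradiction (trans mod3 q≡1) λ ()
... | 1 | _ | _ | _ = refl
... | 2 | _ | mod3 | _ = contradiction (trans mod3 q≡1) λ ()
... | 3 | _ | mod3 | _ = contradiction (trans mod3 q≡1) λ ()
... | 4 | _ | _ | even with prime⇒irreducible q-prime (m%n≡0⇒n∣m q 2 (sym even))
...   | inj₁ ()
...   | inj₂ 2≡q = contradiction (subst (λ x → x % 3 ≡ 1) (sym 2≡q) q≡1) λ ()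
prime≡1mod3⇒≡1mod6 q _ q≡1 | 5 | _ | mod3 | _ = contradiction (trans mod3 q≡1) λ ()
prime≡1mod3⇒≡1mod6 q _ _ | suc (suc (suc (suc (suc (suc _))))) | s≤s (s≤s (s≤s (s≤s (s≤s (s≤s ()))))) | _ | _

-- SignShift ε P M says M = P - ε, recorded on the side where it is additive.
data SignShift : Sign → ℕ → ℕ → Set where
  shift- : ∀ {P} → SignShift Sign.- P (P + 1)
  shift+ : ∀ {M} → SignShift Sign.+ (suc M) M

signShift : ∀ e P → .{{NonZero P}} → SignShift e P ℤ.∣ (ℤ.+ P) ℤ.- sgn e ∣
signShift Sign.- P = shift-
signShift Sign.+ (suc M) = shift+

shift-coprime : ∀ {e P M d} → SignShift e P M → d ∣ P → d ∣ M → d ∣ 1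
shift-coprime shift- d∣P d∣M = ∣m+n∣m⇒∣n d∣M d∣P
shift-coprime {M = M} {d} shift+ d∣P d∣M = ∣m+n∣m⇒∣n (subst (d ∣_) (+-comm 1 M) d∣P) d∣M

-- The residue of -ε modulo d.
negResidue : ∀ d .{{_ : NonZero d}} → Sign → ℕ
negResidue d Sign.- = 1 % d
negResidue d Sign.+ = d ∸ 1

shift-residue : ∀ {e P M} d .{{_ : NonZero d}} → SignShift e P M → d ∣ P → M % d ≡ negResidue d e
shift-residue d shift- d∣P = %-remove-+ˡ 1 d∣P
shift-residue d (shift+ {M}) d∣P = %-pred-≡0 {M} (n∣m⇒m%n≡0 (suc M) d d∣P)

prime-divisor : ∀ m → 2 ≤ m → ∃ λ r → Prime r × r ∣ m
prime-divisor (suc zero) (s≤s ())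
prime-divisor (suc (suc k)) _ with factorise (suc (suc k))
... | record { factors = [] ; isFactorisation = () }
... | record { factors = r ∷ rs ; isFactorisation = m≡Π ; factorsPrime = r-prime ∷ _ } =
  r , r-prime , subst (r ∣_) (sym m≡Π) (∈⇒∣product {ns = r ∷ rs} (here refl))

sole-prime-power : ∀ {q a N} → (∀ r → Prime r → r ∣ N → r ≡ q) →
                   q ^ a ∣ N → ¬ (q ^ suc a ∣ N) → N ≡ q ^ a
sole-prime-power {q} {a} only-q (divides zero N≡0) ¬q^a+1∣N =
  contradiction (subst (q ^ suc a ∣_) (sym N≡0) ((q ^ suc a) ∣0)) ¬q^a+1∣N
sole-prime-power only-q (divides (suc zero) N≡q^a) _ = trans N≡q^a (+-identityʳ _)
sole-prime-power {q} {a} {N} only-q (divides m@(suc (suc _)) N≡m*q^a) ¬q^a+1∣N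
  with prime-divisor m (s≤s (s≤s z≤n))
... | r , r-prime , r∣m = contradiction q^a+1∣N ¬q^a+1∣N
  where
  r∣N : r ∣ N
  r∣N = subst (r ∣_) (sym N≡m*q^a) (∣-trans r∣m (m∣m*n (q ^ a)))

  q∣m : q ∣ m
  q∣m = subst (_∣ m) (only-q r r-prime r∣N) r∣m

  q^a+1∣N : q ^ suc a ∣ N
  q^a+1∣N = subst (q ^ suc a ∣_) (sym N≡m*q^a) (*-monoˡ-∣ (q ^ a) q∣m)

module Complement {n} (S : Setting n) (j : Fin n) where
  open Setting S

  factor : Fin n → ℕ
  factor k = if does (k ∈? ∁ ⁅ j ⁆) then p k ^ v k else 1

  factor-nonZero : ∀ k → NonZero (factor k)
  factor-nonZero k with k ∈? ∁ ⁅ j ⁆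
  ... | no _  = _
  ... | yes _ = m^n≢0 (p k) (v k) {{prime⇒nonZero (p-prime k)}}

  p∣factor : ∀ k → k ≢ j → p k ∣ factor k
  p∣factor k k≢j with k ∈? ∁ ⁅ j ⁆
  ... | no k∉∁j = contradiction (x∉p⇒x∈∁p (x≢y⇒x∉⁅y⁆ k≢j)) k∉∁j
  ... | yes _ with v k | v-pos k
  ...   | suc v' | _ = m∣m*n (p k ^ v')

  P₋-nonZero : NonZero (P₋ j)
  P₋-nonZero = product≢0 (map⁺ {xs = allFin n} (tabulate λ {k} _ → factor-nonZero k))

  p∣P₋ : ∀ k → k ≢ j → p k ∣ P₋ j
  p∣P₋ k k≢j = ∣-trans (p∣factor k k≢j) (∈⇒∣product (∈-map⁺ factor (∈-allFin k)))

  N₋-shift : SignShift (ε₋ j) (P₋ j) (N₋ j)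
  N₋-shift = signShift (ε₋ j) (P₋ j) {{P₋-nonZero}}

  -- If {j} ∈ D^op, p_j is the only prime dividing P_{-j} - ε_{-j}: any other
  -- candidate p_k given by the standing hypothesis divides P_{-j}.
  sole-prime-of-N₋ : InDop₁ j → ∀ r → Prime r → r ∣ N₋ j → r ≡ p j
  sole-prime-of-N₋ j∈Dop r r-prime r∣N with standing (∁ ⁅ j ⁆) j∈Dop r r-prime r∣N
  ... | k , r≡pk with k ≟ j
  ...   | yes refl = r≡pk
  ...   | no k≢j = contradiction (subst Prime r≡1 r-prime) ¬prime[1]
    where
    r≡1 : r ≡ 1
    r≡1 = ∣1⇒≡1 (shift-coprime N₋-shift (subst (_∣ P₋ j) (sym r≡pk) (p∣P₋ k k≢j)) r∣N)

  N₋≡p^α : InDop₁ j → ∀ α → IsAlpha j α → N₋ j ≡ p j ^ α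
  N₋≡p^α j∈Dop α (p^α∣N , ¬p^α+1∣N) = sole-prime-power {a = α} (sole-prime-of-N₋ j∈Dop) p^α∣N ¬p^α+1∣N

Case₁ Case₂ Case₃ : Sign → ℕ → ℕ → Set
Case₁ e a q = e ≡ Sign.- × a % 2 ≡ 0
Case₂ e a q = e ≡ Sign.- × a % 2 ≡ 1 × q % 6 ≡ 1
Case₃ e a q = e ≡ Sign.+ × a % 2 ≡ 1 × q % 3 ≡ 2

cases-disjoint : ∀ e a q → ¬ (Case₁ e a q × Case₂ e a q) × ¬ (Case₁ e a q × Case₃ e a q)
                         × ¬ (Case₂ e a q × Case₃ e a q)
cases-disjoint e a q =
  (λ ((_ , even) , (_ , odd , _)) → contradiction (trans (sym even) odd) λ ()) ,
  (λ ((minus , _) , (plus , _)) → contradiction (trans (sym minus) plus) λ ()) ,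
  (λ ((minus , _) , (plus , _)) → contradiction (trans (sym minus) plus) λ ())

-- q ≡ 0 (mod 3): q^a is a unit mod 3 only for a = 0, where it is 1 ≡ -(-1).
classify-base-0 : ∀ e a q → 0 ^ a % 3 ≡ negResidue 3 e → Case₁ e a q
classify-base-0 Sign.- zero    q _ = refl , refl
classify-base-0 Sign.- (suc a) q ()
classify-base-0 Sign.+ zero    q ()
classify-base-0 Sign.+ (suc a) q ()

-- q ≡ 1 (mod 3): q^a ≡ 1 forces e = -1, and the parity of a decides.
classify-base-1 : ∀ e a q → Prime q → q % 3 ≡ 1 → 1 ≡ negResidue 3 e →
                  Case₁ e a q ⊎ Case₂ e a q
classify-base-1 Sign.+ a q _ _ ()
classify-base-1 Sign.- a q q-prime q≡1 _ with parity a
... | inj₁ even = inj₁ (refl , even)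
... | inj₂ odd  = inj₂ (refl , odd , prime≡1mod3⇒≡1mod6 q q-prime q≡1)

-- q ≡ 2 (mod 3): q^a ≡ (-1)^a, so e = -1 iff a is even.
classify-base-2 : ∀ e a q → q % 3 ≡ 2 → 2 ^ a % 3 ≡ negResidue 3 e →
                  Case₁ e a q ⊎ Case₃ e a q
classify-base-2 e a q q≡2 2^a≡-e with e | powers-of-2-mod-3 a
... | Sign.- | inj₁ (even , _) = inj₁ (refl , even)
... | Sign.+ | inj₂ (odd , _)  = inj₂ (refl , odd , q≡2)
... | Sign.- | inj₂ (_ , 2^a≡2) = contradiction (trans (sym 2^a≡2) 2^a≡-e) λ ()
... | Sign.+ | inj₁ (_ , 2^a≡1) = contradiction (trans (sym 2^a≡1) 2^a≡-e) λ ()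

power-residue : ∀ {q r x} a → q % 3 ≡ r → q ^ a % 3 ≡ x → r ^ a % 3 ≡ x
power-residue {q} a refl q^a≡x = trans (sym (^-%-base q a 3)) q^a≡x

classify : ∀ e a q → Prime q → q ^ a % 3 ≡ negResidue 3 e →
           Case₁ e a q ⊎ Case₂ e a q ⊎ Case₃ e a q
classify e a q q-prime q^a≡-e with residue-mod-3 q
... | inj₁ q≡0 = inj₁ (classify-base-0 e a q (power-residue a q≡0 q^a≡-e))
... | inj₂ (inj₁ q≡1) = map₂ inj₁ (classify-base-1 e a q q-prime q≡1 1≡-e)
  where
  1≡-e : 1 ≡ negResidue 3 e
  1≡-e = trans (sym (cong (_% 3) (^-zeroˡ a))) (power-residue a q≡1 q^a≡-e)
... | inj₂ (inj₂ q≡2) = map₂ inj₂ (classify-base-2 e a q q≡2 (power-residue a q≡2 q^a≡-e))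

lemma1 : ∀ {n} (S : Setting n) → let open Setting S in
    ∀ (i j : Fin n) → p i ≡ 3 → ¬ (j ≡ i) → InDop₁ j →
    ∀ (α : ℕ) → IsAlpha j α →
    ExactlyOne3
      (ε₋ j ≡ Sign.- × α % 2 ≡ 0)
      (ε₋ j ≡ Sign.- × α % 2 ≡ 1 × p j % 6 ≡ 1)
      (ε₋ j ≡ Sign.+ × α % 2 ≡ 1 × p j % 3 ≡ 2)
lemma1 S i j p[i]≡3 j≢i j∈Dop α isα =
  classify (ε₋ j) α (p j) (p-prime j) p[j]^α≡-ε , cases-disjoint (ε₋ j) α (p j)
  where
  open Setting S
  open Complement S j

  3∣P₋ : 3 ∣ P₋ j
  3∣P₋ = subst (_∣ P₋ j) p[i]≡3 (p∣P₋ i (λ i≡j → j≢i (sym i≡j)))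

  p[j]^α≡-ε : p j ^ α % 3 ≡ negResidue 3 (ε₋ j)
  p[j]^α≡-ε = begin
    p j ^ α % 3  ≡⟨ cong (_% 3) (sym (N₋≡p^α j∈Dop α isα)) ⟩
    N₋ j % 3     ≡⟨ shift-residue 3 N₋-shift 3∣P₋ ⟩
    negResidue 3 (ε₋ j) ∎
    where open ≡-Reasoning
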